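{- Let $G$ be a block graph. Then every maximal threshold subgraph of $G$ is a big ant $Q_u(G)=\bigl(V(Q)\cup N_G(u),\ E(Q)\cup\delta_G(u)\bigr)$ for some block $Q$ of $G$ and some vertex $u\in V(Q)$.
   Context: All graphs are finite and simple. $N_G(u)$ denotes the set of neighbours of $u$ and $\delta_G(u)$ the set of edges incident to $u$. A block of a graph is a maximal $2$-connected subgraph (a maximal connected subgraph without a cut-vertex; a bridge with its endpoints is a block); a block graph is a graph in which every block is a complete graph. A threshold graph is a graph that is either a single isolated vertex, or is obtained from a smaller threshold graph by adding an isolated vertex or a universal vertex; equivalently, a graph with no induced $P_4$, $C_4$ or $2K_2$. A threshold subgraph $H$ of $G$ is maximal if there is no threshold subgraph $H'$ of $G$ with $E(H)\subsetneq E(H')$; maximal subgraphs are taken without isolated vertices. -}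

module Defs where

open import Data.Nat using (ℕ)
open import Data.Fin using (Fin)
open import Data.List using (List; []; _∷_)
open import Data.List.Membership.Propositional using (_∈_; _∉_)
open import Data.Product using (Σ; ∃; _×_; _,_)
open import Data.Sum using (_⊎_)
open import Relation.Nullary using (¬_)
open import Relation.Binary.PropositionalEquality using (_≡_; _≢_)

record Graph (n : ℕ) : Set₁ where
  field
    Adj    : Fin n → Fin n → Set
    sym    : ∀ {x y} → Adj x y → Adj y x
    irrefl : ∀ {x} → ¬ Adj x x
open Graph public

VSet : ℕ → Set₁
VSet n = Fin n → Set

module _ {n : ℕ} (G : Graph n) where

  data WalkIn (S : VSet n) : Fin n → Fin n → Set where
    here : ∀ {x} → S x → WalkIn S x x
    step : ∀ {x y z} → S x → Adj G x y → WalkIn S y z → WalkIn S x z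

  -- the induced subgraph G[S] is connected (vacuously so if S is empty)
  ConnectedIn : VSet n → Set
  ConnectedIn S = ∀ x y → S x → S y → WalkIn S x y

  _∖_ : VSet n → Fin n → VSet n
  (S ∖ v) x = S x × x ≢ v

  -- G[S] is nonempty, connected and has no cut-vertex
  -- (K1 and K2 qualify, as in the paper's convention that a bridge is a block)
  NoCutConnected : VSet n → Set
  NoCutConnected S = (∃ λ x → S x) × ConnectedIn S × (∀ v → S v → ConnectedIn (S ∖ v))

  -- a block: a maximal connected subgraph without a cut-vertex
  -- (maximal subgraphs with this property are induced, so we record the vertex set;
  --  the block's edges are the edges of G inside it)
  IsBlock : VSet n → Set₁
  IsBlock S = NoCutConnected S ×
              (∀ (S' : VSet n) → NoCutConnected S' → (∀ x → S x → S' x) → ∀ x → S' x → S x)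

  IsBlockGraph : Set₁
  IsBlockGraph = ∀ (S : VSet n) → IsBlock S → ∀ x y → S x → S y → x ≢ y → Adj G x y

data IsThreshold {n : ℕ} (F : Fin n → Fin n → Set) : List (Fin n) → Set where
  single : ∀ v → IsThreshold F (v ∷ [])
  addIso : ∀ v vs → v ∉ vs → IsThreshold F vs → (∀ w → w ∈ vs → ¬ F v w) → IsThreshold F (v ∷ vs)
  addUni : ∀ v vs → v ∉ vs → IsThreshold F vs → (∀ w → w ∈ vs → F v w) → IsThreshold F (v ∷ vs)

module _ {n : ℕ} (G : Graph n) where

  -- a subgraph without isolated vertices is determined by its edge set F
  IsSubgraphEdges : (Fin n → Fin n → Set) → Set
  IsSubgraphEdges F = (∀ x y → F x y → Adj G x y) × (∀ x y → F x y → F y x)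

  Incident : (Fin n → Fin n → Set) → Fin n → Set
  Incident F x = ∃ λ y → F x y

  IsThresholdSubgraph : (Fin n → Fin n → Set) → Set
  IsThresholdSubgraph F =
    IsSubgraphEdges F ×
    (∃ λ (vs : List (Fin n)) → (∀ x → (x ∈ vs → Incident F x) × (Incident F x → x ∈ vs)) × IsThreshold F vs)

  IsMaximalThresholdSubgraph : (Fin n → Fin n → Set) → Set₁
  IsMaximalThresholdSubgraph F =
    IsThresholdSubgraph F ×
    (∀ (F' : Fin n → Fin n → Set) → IsThresholdSubgraph F' →
       (∀ x y → F x y → F' x y) → ∀ x y → F' x y → F x y)

  -- edge set of the big ant Q_u(G) = (V(Q) ∪ N(u), E(Q) ∪ δ(u)), Q given by vertex set S
  BigAntEdges : VSet n → Fin n → Fin n → Fin n → Set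
  BigAntEdges S u x y = (S x × S y × Adj G x y) ⊎ (x ≡ u × Adj G x y) ⊎ (y ≡ u × Adj G x y)

module Submission where

-- A threshold graph F without isolated vertices has a dominating vertex u (the
-- last one added), and all edges of F - u lie in a core K whose first vertex c
-- is adjacent to the rest of K. So S = {u} ∪ K has no cut-vertex (u and c are
-- both hubs) and F lies in the star at u plus the complete graph on K. In a block
-- graph a set without cut-vertex lies in a block, hence is a clique; then the
-- star plus clique is a threshold subgraph of G and maximality of F makes it
-- equal to F. Maximality also makes S a block: a vertex x outside S lying in a
-- common clique with S would give F the new edge xc. Finally every edge of G at
-- u can be added to the star, so F is exactly the big ant Q_u.

open import Defs
open import Data.Nat using (ℕ; zero; suc)
open import Data.Fin using (Fin; _≟_) renaming (zero to fzero; suc to fsuc)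
open import Data.Fin.Subset using (Subset; _⊂_; _⊃_) renaming (_∈_ to _∈ₛ_)
open import Data.Fin.Subset.Induction using (⊃-wellFounded)
open import Data.List using (List; []; _∷_; _++_; filter; deduplicate)
open import Data.List.Membership.Propositional using (_∈_; _∉_)
open import Data.List.Membership.Propositional.Properties
  using (∈-++⁺ˡ; ∈-++⁺ʳ; ∈-++⁻; ∈-filter⁺; ∈-filter⁻; ∈-deduplicate⁺; ∈-deduplicate⁻)
open import Data.List.Relation.Binary.Subset.Propositional using (_⊆_)
import Data.List.Relation.Unary.All as All
open import Data.List.Relation.Unary.Any using (here; there)
open import Data.List.Relation.Unary.Unique.Propositional using (Unique; _∷_)
open import Data.List.Relation.Unary.Unique.Propositional.Properties
  using (++⁺; filter⁺; Unique[x∷xs]⇒x∉xs)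
open import Data.Product using (Σ; ∃; _×_; _,_; proj₁; proj₂)
open import Data.Sum using (_⊎_; inj₁; inj₂)
open import Data.Vec using (tabulate)
open import Data.Vec.Properties using (lookup∘tabulate; []=⇒lookup; lookup⇒[]=)
open import Data.Empty using (⊥-elim)
open import Function using (_∘_; id)
open import Function.Bundles using (_⇔_; mk⇔; Equivalence)
open import Induction.WellFounded using (Acc; acc)
open import Relation.Nullary using (¬_; yes; no; does)
open import Relation.Nullary.Decidable
  using (dec-true; decidable-stable; ¬¬-excluded-middle; _⊎-dec_)
open import Relation.Unary using (Decidable)
open import Relation.Binary.PropositionalEquality as ≡ using (_≡_; _≢_; refl)

¬¬-decidable : ∀ {n} (P : Fin n → Set) → ¬ ¬ Decidable P
¬¬-decidable {zero} P k = k λ ()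
¬¬-decidable {suc n} P k =
  ¬¬-excluded-middle λ P0? → ¬¬-decidable (P ∘ fsuc) λ Ps? →
    k λ { fzero → P0? ; (fsuc x) → Ps? x }

module _ {n : ℕ} where

  toSubset : {P : Fin n → Set} → Decidable P → Subset n
  toSubset P? = tabulate (does ∘ P?)

  ∈-toSubset : {P : Fin n → Set} (P? : Decidable P) → ∀ x → P x ⇔ x ∈ₛ toSubset P?
  ∈-toSubset {P} P? x = mk⇔ to from
    where
    to : P x → x ∈ₛ toSubset P?
    to px = lookup⇒[]= x _ (≡.trans (lookup∘tabulate _ x) (dec-true (P? x) px))
    from : x ∈ₛ toSubset P? → P x
    from x∈ with P? x | ≡.trans (≡.sym (lookup∘tabulate (does ∘ P?) x)) ([]=⇒lookup x∈)
    ... | yes px | _ = px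
    ... | no _   | ()

  ⊂-toSubset : {P Q : Fin n → Set} (P? : Decidable P) (Q? : Decidable Q) → (∀ x → P x → Q x) →
    ∀ x → Q x → ¬ P x → toSubset P? ⊂ toSubset Q?
  ⊂-toSubset P? Q? P⊆Q x Qx ¬Px =
    (λ {y} → to (∈-toSubset Q? y) ∘ P⊆Q y ∘ from (∈-toSubset P? y)) ,
    x , to (∈-toSubset Q? x) Qx , ¬Px ∘ from (∈-toSubset P? x)
    where open Equivalence

module _ {n : ℕ} (G : Graph n) where

  Clique : VSet n → Set
  Clique S = ∀ x y → S x → S y → x ≢ y → Adj G x y

  BlockAbove : VSet n → Set₁
  BlockAbove S = Σ (VSet n) λ B → IsBlock G B × (∀ x → S x → B x)

  -- Adjacency is not decidable, so a block above S exists only up to double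
  -- negation; the extension terminates because the decided sets strictly grow.
  ¬¬-blockAbove : ∀ S → NoCutConnected G S → ¬ ¬ BlockAbove S
  ¬¬-blockAbove S ncc noBlock =
    ¬¬-decidable S λ S? → extend S S? (⊃-wellFounded _) ncc noBlock
    where
    extend : ∀ S (S? : Decidable S) → Acc _⊃_ (toSubset S?) → NoCutConnected G S →
             ¬ ¬ BlockAbove S
    extend S S? (acc larger) ncc noBlock = noBlock (S , (ncc , maximal) , λ _ Sx → Sx)
      where
      maximal : ∀ S′ → NoCutConnected G S′ → (∀ x → S x → S′ x) → ∀ x → S′ x → S x
      maximal S′ ncc′ S⊆S′ x S′x = decidable-stable (S? x) λ x∉S → ¬¬-decidable S′ λ S′? →
        extend S′ S′? (larger (⊂-toSubset S? S′? S⊆S′ x S′x x∉S)) ncc′ λ (B , block , S′⊆B) →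
          noBlock (B , block , λ y Sy → S′⊆B y (S⊆S′ y Sy))

  ¬¬-clique : IsBlockGraph G → ∀ S → NoCutConnected G S → ¬ ¬ Clique S
  ¬¬-clique blockGraph S ncc noClique = ¬¬-blockAbove S ncc λ (B , block , S⊆B) →
    noClique λ x y Sx Sy → blockGraph B block x y (S⊆B x Sx) (S⊆B y Sy)

  hub⇒connectedIn : ∀ {S h} → S h → (∀ z → S z → z ≢ h → Adj G z h) → ConnectedIn G S
  hub⇒connectedIn {S} {h} Sh toHub x y Sx Sy = viaHub x Sx
    where
    fromHub : WalkIn G S h y
    fromHub with y ≟ h
    ... | yes refl = here Sh
    ... | no y≢h = step Sh (sym G (toHub y Sy y≢h)) (here Sy)
    viaHub : ∀ x → S x → WalkIn G S x y
    viaHub x Sx with x ≟ h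
    ... | yes refl = fromHub
    ... | no x≢h = step Sx (toHub x Sx x≢h) fromHub

  twoHubs⇒noCutConnected : ∀ {S h h′} → S h → S h′ → h ≢ h′ →
    (∀ z → S z → z ≢ h → Adj G z h) → (∀ z → S z → z ≢ h′ → Adj G z h′) →
    NoCutConnected G S
  twoHubs⇒noCutConnected {S} {h} {h′} Sh Sh′ h≢h′ toHub toHub′ =
    (h , Sh) , hub⇒connectedIn Sh toHub , withoutVertex
    where
    withoutVertex : ∀ v → S v → ConnectedIn G (_∖_ G S v)
    withoutVertex v _ with h ≟ v
    ... | yes refl = hub⇒connectedIn (Sh′ , h≢h′ ∘ ≡.sym) λ z (Sz , _) → toHub′ z Sz
    ... | no h≢v = hub⇒connectedIn (Sh , h≢v) λ z (Sz , _) → toHub z Sz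

module _ {n : ℕ} {F : Fin n → Fin n → Set} where

  complete⇒isThreshold : ∀ {x xs} → Unique (x ∷ xs) →
    (∀ a b → a ∈ x ∷ xs → b ∈ x ∷ xs → a ≢ b → F a b) → IsThreshold F (x ∷ xs)
  complete⇒isThreshold {x} {[]} _ _ = single x
  complete⇒isThreshold {x} {y ∷ ys} uniq@(x≢ ∷ uniq′) complete =
    addUni x (y ∷ ys) (Unique[x∷xs]⇒x∉xs uniq)
      (complete⇒isThreshold uniq′ λ a b a∈ b∈ → complete a b (there a∈) (there b∈))
      (λ w w∈ → complete x w (here refl) (there w∈) (All.lookup x≢ w∈))

  isolated++⇒isThreshold : ∀ xs {ys} → Unique (xs ++ ys) → IsThreshold F ys →
    (∀ a b → a ∈ xs → b ∈ xs ++ ys → ¬ F a b) → IsThreshold F (xs ++ ys)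
  isolated++⇒isThreshold [] _ thr _ = thr
  isolated++⇒isThreshold (x ∷ xs) uniq@(_ ∷ uniq′) thr isolated =
    addIso x (xs ++ _) (Unique[x∷xs]⇒x∉xs uniq)
      (isolated++⇒isThreshold xs uniq′ thr λ a b a∈ b∈ → isolated a b (there a∈) (there b∈))
      (λ w w∈ → isolated x w (here refl) (there w∈))

  record ThresholdCore (vs : List (Fin n)) : Set where
    field
      centre : Fin n
      others : List (Fin n)
      core⊆ : centre ∷ others ⊆ vs
      centre-adjacent : ∀ t → t ∈ others → F centre t
      edge⇒inCore : ∀ x y → x ∈ vs → y ∈ vs → F x y → x ∈ centre ∷ others

  thresholdCore : (∀ x y → F x y → F y x) → (∀ x → ¬ F x x) →
    ∀ {vs} → IsThreshold F vs → ThresholdCore vs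
  thresholdCore _ _ (single v) = record
    { centre = v ; others = [] ; core⊆ = id
    ; centre-adjacent = λ _ () ; edge⇒inCore = λ _ _ x∈ _ _ → x∈ }
  thresholdCore _ _ (addUni v vs _ _ universal) = record
    { centre = v ; others = vs ; core⊆ = id
    ; centre-adjacent = universal ; edge⇒inCore = λ _ _ x∈ _ _ → x∈ }
  thresholdCore symF irrF (addIso v vs _ thr isolated) = record
    { centre = centre ; others = others ; core⊆ = λ z∈ → there (core⊆ z∈)
    ; centre-adjacent = centre-adjacent ; edge⇒inCore = inCore }
    where
    open ThresholdCore (thresholdCore symF irrF thr)
    inCore : ∀ x y → x ∈ v ∷ vs → y ∈ v ∷ vs → F x y → x ∈ centre ∷ others
    inCore x _ (here refl) (here refl) f = ⊥-elim (irrF x f)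
    inCore _ y (here refl) (there y∈) f = ⊥-elim (isolated y y∈ f)
    inCore x y (there x∈) (here refl) f = ⊥-elim (isolated x x∈ (symF x y f))
    inCore x y (there x∈) (there y∈) f = edge⇒inCore x y x∈ y∈ f

module _ {n : ℕ} where

  StarClique : Fin n → List (Fin n) → List (Fin n) → Fin n → Fin n → Set
  StarClique u N K x y = (x ≡ u × y ∈ N) ⊎ (y ≡ u × x ∈ N) ⊎ (x ∈ K × y ∈ K × x ≢ y)

  starClique-sym : ∀ {u N K} x y → StarClique u N K x y → StarClique u N K y x
  starClique-sym _ _ (inj₁ star) = inj₂ (inj₁ star)
  starClique-sym _ _ (inj₂ (inj₁ star)) = inj₁ star
  starClique-sym _ _ (inj₂ (inj₂ (x∈ , y∈ , x≢y))) = inj₂ (inj₂ (y∈ , x∈ , x≢y ∘ ≡.sym))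

  starClique-mono : ∀ {u N N′ K K′} → N ⊆ N′ → K ⊆ K′ →
    ∀ x y → StarClique u N K x y → StarClique u N′ K′ x y
  starClique-mono N⊆ _ _ _ (inj₁ (x≡u , y∈)) = inj₁ (x≡u , N⊆ y∈)
  starClique-mono N⊆ _ _ _ (inj₂ (inj₁ (y≡u , x∈))) = inj₂ (inj₁ (y≡u , N⊆ x∈))
  starClique-mono _ K⊆ _ _ (inj₂ (inj₂ (x∈ , y∈ , x≢y))) = inj₂ (inj₂ (K⊆ x∈ , K⊆ y∈ , x≢y))

  open import Data.List.Membership.DecPropositional (_≟_ {n}) using (_∈?_; _∉?_)
  open import Data.List.Relation.Unary.Unique.DecPropositional.Properties (_≟_ {n})
    using (deduplicate-!)

  leaves : List (Fin n) → List (Fin n) → List (Fin n)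
  leaves N K = filter (_∉? K) (deduplicate _≟_ N)

  ∈-leaves⁻ : ∀ N {K z} → z ∈ leaves N K → z ∈ N × z ∉ K
  ∈-leaves⁻ N {K} z∈ with ∈-filter⁻ (_∉? K) {xs = deduplicate _≟_ N} z∈
  ... | z∈N , z∉K = ∈-deduplicate⁻ _≟_ N z∈N , z∉K

  ∈-leaves++⁻ : ∀ N {K z} → K ⊆ N → z ∈ leaves N K ++ deduplicate _≟_ K → z ∈ N
  ∈-leaves++⁻ N {K} K⊆N z∈ with ∈-++⁻ (leaves N K) z∈
  ... | inj₁ z∈leaves = proj₁ (∈-leaves⁻ N z∈leaves)
  ... | inj₂ z∈K = K⊆N (∈-deduplicate⁻ _≟_ K z∈K)

  ∈-leaves++⁺ : ∀ {N K z} → z ∈ N → z ∈ leaves N K ++ deduplicate _≟_ K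
  ∈-leaves++⁺ {N} {K} {z} z∈N with z ∈? K
  ... | yes z∈K = ∈-++⁺ʳ (leaves N K) (∈-deduplicate⁺ _≟_ z∈K)
  ... | no z∉K = ∈-++⁺ˡ (∈-filter⁺ (_∉? K) (∈-deduplicate⁺ _≟_ z∈N) z∉K)

  leaves++-unique : ∀ N K → Unique (leaves N K ++ deduplicate _≟_ K)
  leaves++-unique N K = ++⁺ (filter⁺ (_∉? K) (deduplicate-! N)) (deduplicate-! K)
    λ (z∈leaves , z∈K) → proj₂ (∈-leaves⁻ N z∈leaves) (∈-deduplicate⁻ _≟_ K z∈K)

  -- u is added last as a universal vertex, before it the leaves outside K as
  -- isolated vertices, and first the clique K.
  starClique-isThresholdSubgraph : ∀ (G : Graph n) {u N k ks} → u ∉ N →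
    (∀ z → z ∈ N → Adj G u z) → k ∷ ks ⊆ N → Clique G (_∈ k ∷ ks) →
    IsThresholdSubgraph G (StarClique u N (k ∷ ks))
  starClique-isThresholdSubgraph G {u} {N} {k} {ks} u∉N u-adj K⊆N clique =
    (edge⇒adj , starClique-sym) , u ∷ leaves N K ++ core , vertices ,
    addUni u _ (u∉N ∘ ∈-leaves++⁻ N K⊆N) threshold λ w w∈ → inj₁ (refl , ∈-leaves++⁻ N K⊆N w∈)
    where
    K core : List (Fin n)
    K = k ∷ ks
    core = deduplicate _≟_ K

    edge⇒adj : ∀ x y → StarClique u N K x y → Adj G x y
    edge⇒adj _ _ (inj₁ (refl , y∈)) = u-adj _ y∈
    edge⇒adj _ _ (inj₂ (inj₁ (refl , x∈))) = sym G (u-adj _ x∈)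
    edge⇒adj x y (inj₂ (inj₂ (x∈ , y∈ , x≢y))) = clique x y x∈ y∈ x≢y

    vertices : ∀ x → (x ∈ u ∷ leaves N K ++ core → Incident G (StarClique u N K) x)
                   × (Incident G (StarClique u N K) x → x ∈ u ∷ leaves N K ++ core)
    vertices x = to , from
      where
      to : x ∈ u ∷ leaves N K ++ core → Incident G (StarClique u N K) x
      to (here refl) = k , inj₁ (refl , K⊆N (here refl))
      to (there x∈) = u , inj₂ (inj₁ (refl , ∈-leaves++⁻ N K⊆N x∈))
      from : Incident G (StarClique u N K) x → x ∈ u ∷ leaves N K ++ core
      from (_ , inj₁ (x≡u , _)) = here x≡u
      from (_ , inj₂ (inj₁ (_ , x∈N))) = there (∈-leaves++⁺ x∈N)
      from (_ , inj₂ (inj₂ (x∈K , _))) = there (∈-leaves++⁺ (K⊆N x∈K))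

    isolated : ∀ a b → a ∈ leaves N K → b ∈ leaves N K ++ core → ¬ StarClique u N K a b
    isolated _ _ a∈ _ (inj₁ (refl , _)) = u∉N (proj₁ (∈-leaves⁻ N a∈))
    isolated _ _ _ b∈ (inj₂ (inj₁ (refl , _))) = u∉N (∈-leaves++⁻ N K⊆N b∈)
    isolated _ _ a∈ _ (inj₂ (inj₂ (a∈K , _))) = proj₂ (∈-leaves⁻ N a∈) a∈K

    threshold : IsThreshold (StarClique u N K) (leaves N K ++ core)
    threshold = isolated++⇒isThreshold (leaves N K) (leaves++-unique N K)
      (complete⇒isThreshold (deduplicate-! K) λ a b a∈ b∈ a≢b →
         inj₂ (inj₂ (∈-deduplicate⁻ _≟_ K a∈ , ∈-deduplicate⁻ _≟_ K b∈ , a≢b)))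
      isolated

module _ {n : ℕ} (G : Graph n) {F : Fin n → Fin n → Set} where

  record ApexDecomposition : Set where
    field
      apex : Fin n
      rest : List (Fin n)
      apex∉rest : apex ∉ rest
      apex-adjacent : ∀ w → w ∈ rest → F apex w
      incident⇒∈ : ∀ x y → F x y → x ∈ apex ∷ rest
      core : ThresholdCore {F = F} rest

  apexDecomposition : IsThresholdSubgraph G F → ApexDecomposition
  apexDecomposition ((F⊆G , symF) , vs , vertices , thr) = decompose thr vertices
    where
    irrF : ∀ x → ¬ F x x
    irrF x = irrefl G ∘ F⊆G x x

    VertexList : List (Fin n) → Set
    VertexList vs = ∀ x → (x ∈ vs → Incident G F x) × (Incident G F x → x ∈ vs)

    neighbourInTail : ∀ {v vs} → VertexList (v ∷ vs) → ∃ λ y → y ∈ vs × F v y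
    neighbourInTail {v} V with proj₁ (V v) (here refl)
    ... | y , f with proj₂ (V y) (v , symF v y f)
    ... | here refl = ⊥-elim (irrF v f)
    ... | there y∈ = y , y∈ , f

    decompose : ∀ {vs} → IsThreshold F vs → VertexList vs → ApexDecomposition
    decompose (single _) V with neighbourInTail V
    ... | _ , () , _
    decompose (addIso _ _ _ _ isolated) V with neighbourInTail V
    ... | y , y∈ , f = ⊥-elim (isolated y y∈ f)
    decompose (addUni u rest u∉ thr universal) V = record
      { apex = u ; rest = rest ; apex∉rest = u∉ ; apex-adjacent = universal
      ; incident⇒∈ = λ x y f → proj₂ (V x) (y , f) ; core = thresholdCore symF irrF thr }

module MaximalThresholdSubgraph {n : ℕ} {G : Graph n} (blockGraph : IsBlockGraph G)
  {F : Fin n → Fin n → Set} (maximal : IsMaximalThresholdSubgraph G F) where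

  open import Data.List.Membership.DecPropositional (_≟_ {n}) using (_∈?_)

  F⊆G : ∀ x y → F x y → Adj G x y
  F⊆G = proj₁ (proj₁ (proj₁ maximal))

  symF : ∀ x y → F x y → F y x
  symF = proj₂ (proj₁ (proj₁ maximal))

  open ApexDecomposition (apexDecomposition G (proj₁ maximal)) public
  open ThresholdCore core

  K : List (Fin n)
  K = centre ∷ others

  S : VSet n
  S x = x ≡ apex ⊎ x ∈ K

  apex-adj : ∀ z → z ∈ rest → Adj G apex z
  apex-adj z z∈ = F⊆G apex z (apex-adjacent z z∈)

  apex≢centre : apex ≢ centre
  apex≢centre apex≡centre = apex∉rest (core⊆ (here apex≡centre))

  edge⇒starClique : ∀ x y → F x y → StarClique apex rest K x y
  edge⇒starClique x y f with incident⇒∈ x y f | incident⇒∈ y x (symF x y f)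
  ... | here refl | here refl = ⊥-elim (irrefl G (F⊆G x y f))
  ... | here x≡apex | there y∈ = inj₁ (x≡apex , y∈)
  ... | there x∈ | here y≡apex = inj₂ (inj₁ (y≡apex , x∈))
  ... | there x∈ | there y∈ = inj₂ (inj₂ (edge⇒inCore x y x∈ y∈ f ,
          edge⇒inCore y x y∈ x∈ (symF x y f) , λ { refl → irrefl G (F⊆G x y f) }))

  starClique⊆F : ∀ {N k ks} → apex ∉ N → (∀ z → z ∈ N → Adj G apex z) →
    rest ⊆ N → K ⊆ k ∷ ks → k ∷ ks ⊆ N → Clique G (_∈ k ∷ ks) →
    ∀ x y → StarClique apex N (k ∷ ks) x y → F x y
  starClique⊆F apex∉N apex-adjN rest⊆N K⊆ ⊆N clique =
    proj₂ maximal _ (starClique-isThresholdSubgraph G apex∉N apex-adjN ⊆N clique)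
      λ x y f → starClique-mono rest⊆N K⊆ x y (edge⇒starClique x y f)

  centre-neighbour⇒S : ∀ x → F x centre → S x
  centre-neighbour⇒S x f with edge⇒starClique x centre f
  ... | inj₁ (x≡apex , _) = inj₁ x≡apex
  ... | inj₂ (inj₁ (centre≡apex , _)) = ⊥-elim (apex≢centre (≡.sym centre≡apex))
  ... | inj₂ (inj₂ (x∈K , _)) = inj₂ x∈K

  cliqueExtension⇒F-centre : ∀ {S′} x → ¬ S x → S′ x → (∀ z → S z → S′ z) → Clique G S′ →
    F x centre
  cliqueExtension⇒F-centre {S′} x x∉S S′x S⊆S′ clique =
    starClique⊆F apex∉N apex-adjN there there K⊆N
      (λ a b a∈ b∈ → clique a b (inS′ a∈) (inS′ b∈))
      x centre (inj₂ (inj₂ (here refl , there (here refl) , x∉S ∘ inj₂ ∘ here)))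
    where
    apex∉N : apex ∉ x ∷ rest
    apex∉N (here apex≡x) = x∉S (inj₁ (≡.sym apex≡x))
    apex∉N (there apex∈) = apex∉rest apex∈
    apex-adjN : ∀ z → z ∈ x ∷ rest → Adj G apex z
    apex-adjN _ (here refl) = clique apex x (S⊆S′ apex (inj₁ refl)) S′x (x∉S ∘ inj₁ ∘ ≡.sym)
    apex-adjN z (there z∈) = apex-adj z z∈
    K⊆N : x ∷ K ⊆ x ∷ rest
    K⊆N (here z≡x) = here z≡x
    K⊆N (there z∈) = there (core⊆ z∈)
    inS′ : ∀ {z} → z ∈ x ∷ K → S′ z
    inS′ (here refl) = S′x
    inS′ (there z∈) = S⊆S′ _ (inj₂ z∈)

  S-noCutConnected : NoCutConnected G S
  S-noCutConnected =
    twoHubs⇒noCutConnected G (inj₁ refl) (inj₂ (here refl)) apex≢centre toApex toCentre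
    where
    toApex : ∀ z → S z → z ≢ apex → Adj G z apex
    toApex z (inj₁ z≡apex) z≢apex = ⊥-elim (z≢apex z≡apex)
    toApex z (inj₂ z∈K) _ = sym G (apex-adj z (core⊆ z∈K))
    toCentre : ∀ z → S z → z ≢ centre → Adj G z centre
    toCentre _ (inj₁ refl) _ = apex-adj centre (core⊆ (here refl))
    toCentre z (inj₂ (here z≡centre)) z≢centre = ⊥-elim (z≢centre z≡centre)
    toCentre z (inj₂ (there z∈)) _ = sym G (F⊆G centre z (centre-adjacent z z∈))

  S-maximal : ∀ S′ → NoCutConnected G S′ → (∀ x → S x → S′ x) → ∀ x → S′ x → S x
  S-maximal S′ ncc S⊆S′ x S′x =
    decidable-stable ((x ≟ apex) ⊎-dec (x ∈? K)) λ x∉S →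
      ¬¬-clique G blockGraph S′ ncc λ clique →
        x∉S (centre-neighbour⇒S x (cliqueExtension⇒F-centre x x∉S S′x S⊆S′ clique))

  S-isBlock : IsBlock G S
  S-isBlock = S-noCutConnected , S-maximal

  K-clique : Clique G (_∈ K)
  K-clique a b a∈ b∈ = blockGraph S S-isBlock a b (inj₂ a∈) (inj₂ b∈)

  apex-edge : ∀ y → Adj G apex y → F apex y
  apex-edge y a = starClique⊆F apex∉N apex-adjN there id (there ∘ core⊆) K-clique
    apex y (inj₁ (refl , here refl))
    where
    apex∉N : apex ∉ y ∷ rest
    apex∉N (here apex≡y) = irrefl G (≡.subst (Adj G apex) (≡.sym apex≡y) a)
    apex∉N (there apex∈) = apex∉rest apex∈
    apex-adjN : ∀ z → z ∈ y ∷ rest → Adj G apex z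
    apex-adjN _ (here refl) = a
    apex-adjN z (there z∈) = apex-adj z z∈

  core-edge : ∀ x y → x ∈ K → y ∈ K → Adj G x y → F x y
  core-edge x y x∈ y∈ a =
    starClique⊆F apex∉rest apex-adj id id core⊆ K-clique
      x y (inj₂ (inj₂ (x∈ , y∈ , λ { refl → irrefl G a })))

  edge⇒bigAnt : ∀ x y → F x y → BigAntEdges G S apex x y
  edge⇒bigAnt x y f with edge⇒starClique x y f
  ... | inj₁ (x≡apex , _) = inj₂ (inj₁ (x≡apex , F⊆G x y f))
  ... | inj₂ (inj₁ (y≡apex , _)) = inj₂ (inj₂ (y≡apex , F⊆G x y f))
  ... | inj₂ (inj₂ (x∈K , y∈K , _)) = inj₁ (inj₂ x∈K , inj₂ y∈K , F⊆G x y f)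

  bigAnt⇒edge : ∀ x y → BigAntEdges G S apex x y → F x y
  bigAnt⇒edge _ y (inj₁ (inj₁ refl , _ , a)) = apex-edge y a
  bigAnt⇒edge x _ (inj₁ (inj₂ _ , inj₁ refl , a)) = symF apex x (apex-edge x (sym G a))
  bigAnt⇒edge x y (inj₁ (inj₂ x∈K , inj₂ y∈K , a)) = core-edge x y x∈K y∈K a
  bigAnt⇒edge _ y (inj₂ (inj₁ (refl , a))) = apex-edge y a
  bigAnt⇒edge x _ (inj₂ (inj₂ (refl , a))) = symF apex x (apex-edge x (sym G a))

lemma12 : ∀ {n : ℕ} (G : Graph n) → IsBlockGraph G →
    ∀ (F : Fin n → Fin n → Set) → IsMaximalThresholdSubgraph G F →
    Σ (VSet n) λ S → IsBlock G S × Σ (Fin n) λ u → S u ×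
      (∀ x y → F x y ⇔ BigAntEdges G S u x y)
lemma12 G blockGraph F maximal =
  S , S-isBlock , apex , inj₁ refl , λ x y → mk⇔ (edge⇒bigAnt x y) (bigAnt⇒edge x y)
  where open MaximalThresholdSubgraph blockGraph maximal
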